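{- For every forest $F$ (finite, simple, acyclic graph), $D_t(F,-1)\in\{0,1\}$.
   Context: A set $D\subseteq V(G)$ of a finite simple graph $G$ is a total dominating set if every vertex of $G$ is adjacent to some vertex of $D$. With $d_t(G,i)$ the number of total dominating sets of size $i$, the total domination polynomial is $D_t(G,x)=\sum_{i=1}^{|V(G)|}d_t(G,i)x^i$ (so it is $0$ for the graph with no vertices). -}

module Defs where

open import Data.Bool using (Bool; true; false)
open import Data.Nat using (ℕ; zero; suc)
open import Data.Fin using (Fin; zero; suc; inject₁; fromℕ)
open import Data.Fin.Subset using (Subset; inside; outside; _∈_; ∣_∣)
open import Data.Fin.Subset.Properties using (_∈?_)
open import Data.Fin.Properties using (all?; any?)
open import Data.Vec using (Vec; []; _∷_)
open import Data.List using (List; []; _∷_; _++_; map; filter; length)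
open import Data.Integer using (ℤ; +_; _+_; _*_; _^_; -1ℤ; 0ℤ)
open import Data.Product using (Σ; ∃; _×_; _,_)
open import Relation.Nullary using (¬_; Dec)
open import Relation.Nullary.Decidable using (_×-dec_)
open import Relation.Binary.PropositionalEquality using (_≡_)
open import Data.Bool.Properties using () renaming (_≟_ to _≟B_)
import Data.Nat as ℕ
open import Function.Definitions using (Injective)

record Graph : Set where
  field
    n      : ℕ
    adj    : Fin n → Fin n → Bool
    sym    : ∀ u v → adj u v ≡ adj v u
    irrefl : ∀ v → adj v v ≡ false
open Graph public

record Cycle (G : Graph) : Set where
  field
    k       : ℕ
    c       : Fin (suc (suc (suc k))) → Fin (n G)
    c-inj   : Injective _≡_ _≡_ c
    c-step  : ∀ (i : Fin (suc (suc k))) → adj G (c (inject₁ i)) (c (suc i)) ≡ true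
    c-close : adj G (c (fromℕ (suc (suc k)))) (c zero) ≡ true

IsForest : Graph → Set
IsForest G = ¬ Cycle G

IsTotalDominating : (G : Graph) → Subset (n G) → Set
IsTotalDominating G D = ∀ v → ∃ λ u → u ∈ D × adj G v u ≡ true

isTotalDominating? : (G : Graph) → (D : Subset (n G)) → Dec (IsTotalDominating G D)
isTotalDominating? G D = all? λ v → any? λ u → (u ∈? D) ×-dec (adj G v u ≟B true)

allSubsets : (m : ℕ) → List (Subset m)
allSubsets zero = [] ∷ []
allSubsets (suc m) = map (inside ∷_) (allSubsets m) ++ map (outside ∷_) (allSubsets m)

dt : (G : Graph) → ℕ → ℕ
dt G i = length (filter (λ D → (∣ D ∣ ℕ.≟ i) ×-dec isTotalDominating? G D) (allSubsets (n G)))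

sum1to : ℕ → (ℕ → ℤ) → ℤ
sum1to zero f = 0ℤ
sum1to (suc m) f = sum1to m f + f (suc m)

Dt : Graph → ℤ → ℤ
Dt G x = sum1to (n G) (λ i → (+ dt G i) * (x ^ i))

-- For vertex sets S, T let Φ S T be the signed count Σ (-1)^|D| of the sets D ⊆ T in which
-- every vertex of S has a neighbour, so that D_t(G,-1) = Φ V V for V ≠ ∅.  Toggling one
-- vertex a pairs the subsets up: if v ∈ S has a as its only neighbour in T then
-- Φ S T = - Φ (S ∖ N(a)) (T ∖ a), and if a ∈ T has v as its only neighbour in S then
-- Φ S T = - Φ (S ∖ v) (T ∖ N(v)).  For a vertex ℓ of S whose only neighbour in S is s, the
-- two rules combine to Φ S S = Φ R R with R = S ∖ N[s] smaller than S.  In a forest every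
-- nonempty S has a vertex with at most one neighbour in S (otherwise a non-backtracking walk
-- inside S closes a cycle), so the reduction ends at S = ∅, where Φ = 1, or at a vertex
-- without neighbours in S, where Φ = 0.
module Submission where

open import Data.Bool using (true; false; if_then_else_)
open import Data.Bool.Properties using () renaming (_≟_ to _≟ᵇ_)
open import Data.Empty using (⊥-elim)
open import Data.Fin using (Fin; zero; suc; toℕ; fromℕ<) renaming (_≟_ to _≟ᶠ_)
open import Data.Fin.Properties
  using (any?; all?; pigeonhole; toℕ-injective; toℕ<n; toℕ-inject₁; toℕ-fromℕ; toℕ-fromℕ<)
open import Data.Fin.Subset
  using (Subset; inside; outside; _∈_; _∉_; _⊆_; ⊥; ⊤; ∣_∣; Nonempty; _─_; _-_; ⁅_⁆)
open import Data.Fin.Subset.Properties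
  using ( _∈?_; _⊆?_; drop-there; x∈⁅x⁆; ∈⊤; ⊥⊆; ∉⊥; ∣⊥∣≡0; ∣p∣≤n; nonempty?; Empty-unique
        ; p─q⊆p; x∈p∧x∉q⇒x∈p─q; x∈p∧x≢y⇒x∈p-y; p─q─r≡p─r─q; ∣p─q∣≤∣p∣; x∈p⇒∣p-x∣<∣p∣ )
open import Data.Integer using (ℤ; _+_; _*_; -_; _^_; 0ℤ; 1ℤ; -1ℤ)
open import Data.Integer.Properties
  using ( +-identityˡ; +-identityʳ; +-assoc; +-inverseˡ; neg-distrib-+; neg-involutive
        ; -1*i≡-i; *-identityˡ; *-distribʳ-+; +-commutativeSemigroup )
open import Algebra.Properties.CommutativeSemigroup +-commutativeSemigroup using (interchange)
open import Data.List using (List; []; _∷_; _++_; map; foldr; filter; length)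
open import Data.Nat using (ℕ; zero; suc; _<_; _≤_; z≤n; s≤s)
import Data.Nat as ℕ
import Data.Integer as ℤ
open import Data.Nat.Induction using (<-wellFounded)
open import Data.Nat.Properties
  using ( ≤-refl; ≤-<-trans; <-irrefl; <-cmp; +-comm; +-monoˡ-<; n<1+n; ≤∧≢⇒<
        ; m<1+n⇒m≤n; m≤n⇒m≤1+n; m<1+n⇒m<n∨m≡n; m≤n⇒∃[o]m+o≡n )
open import Data.Product using (∃; ∃₂; _×_; _,_)
open import Data.Sum using (_⊎_; inj₁; inj₂)
open import Data.Vec using (_∷_; tabulate; _[_]≔_; here; there)
open import Data.Vec.Properties
  using (lookup∘tabulate; []=⇒lookup; lookup⇒[]=; []≔-updates; []≔-minimal; []≔-idempotent; []≔-lookup)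
open import Function using (_∘_; _⇔_; mk⇔)
open import Induction.WellFounded using (Acc; acc)
open import Relation.Binary.Definitions using (tri<; tri≈; tri>)
open import Relation.Binary.PropositionalEquality
open import Relation.Nullary using (Dec; yes; no; does; ¬_; contradiction)
open import Relation.Nullary.Decidable
  using (_×-dec_; _→-dec_; ¬?; does-⇔; dec-true; dec-false; decidable-stable)
open import Relation.Unary using (Decidable)
open import Defs
  using ( Graph; n; adj; irrefl; Cycle; IsForest; IsTotalDominating; isTotalDominating?
        ; allSubsets; dt; sum1to; Dt )

private variable
  A B P Q : Set
  m : ℕ

infixr 7 [_]·_

[_]·_ : Dec P → ℤ → ℤ
[ p? ]· x = if does p? then x else 0ℤ

[]·-⇔ : P ⇔ Q → (p? : Dec P) (q? : Dec Q) (x : ℤ) → [ p? ]· x ≡ [ q? ]· x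
[]·-⇔ P⇔Q p? q? x = cong (λ b → if b then x else 0ℤ) (does-⇔ P⇔Q p? q?)

[]·-yes : P → (p? : Dec P) (x : ℤ) → [ p? ]· x ≡ x
[]·-yes p p? x = cong (λ b → if b then x else 0ℤ) (dec-true p? p)

[]·-no : ¬ P → (p? : Dec P) (x : ℤ) → [ p? ]· x ≡ 0ℤ
[]·-no ¬p p? x = cong (λ b → if b then x else 0ℤ) (dec-false p? ¬p)

[]·-neg : (p? : Dec P) (x : ℤ) → [ p? ]· (- x) ≡ - ([ p? ]· x)
[]·-neg (yes _) x = refl
[]·-neg (no  _) x = refl

[]·-×-dec : (p? : Dec P) (q? : Dec Q) (x : ℤ) → [ p? ×-dec q? ]· x ≡ [ q? ]· [ p? ]· x
[]·-×-dec (yes _) (yes _) x = refl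
[]·-×-dec (yes _) (no  _) x = refl
[]·-×-dec (no  _) (yes _) x = refl
[]·-×-dec (no  _) (no  _) x = refl

[]·-complement : (p? : Dec P) (q? : Dec Q) (x : ℤ) →
                 [ p? ]· (- x) + [ p? ×-dec q? ]· x ≡ - ([ p? ×-dec ¬? q? ]· x)
[]·-complement (yes _) (yes _) x = +-inverseˡ x
[]·-complement (yes _) (no  _) x = +-identityʳ (- x)
[]·-complement (no  _) _       x = refl

∑ : List A → (A → ℤ) → ℤ
∑ xs f = foldr (λ x s → f x + s) 0ℤ xs

∑-cong : ∀ (xs : List A) {f g} → (∀ x → f x ≡ g x) → ∑ xs f ≡ ∑ xs g
∑-cong []       _   = refl
∑-cong (x ∷ xs) f≗g = cong₂ _+_ (f≗g x) (∑-cong xs f≗g)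

∑-zero : ∀ (xs : List A) {f} → (∀ x → f x ≡ 0ℤ) → ∑ xs f ≡ 0ℤ
∑-zero []       _   = refl
∑-zero (x ∷ xs) f≗0 rewrite f≗0 x = trans (+-identityˡ _) (∑-zero xs f≗0)

∑-+ : ∀ (xs : List A) f g → ∑ xs (λ x → f x + g x) ≡ ∑ xs f + ∑ xs g
∑-+ []       f g = refl
∑-+ (x ∷ xs) f g =
  trans (cong (f x + g x +_) (∑-+ xs f g)) (interchange (f x) (g x) (∑ xs f) (∑ xs g))

∑-neg : ∀ (xs : List A) f → ∑ xs (λ x → - f x) ≡ - ∑ xs f
∑-neg []       f = refl
∑-neg (x ∷ xs) f = trans (cong (- f x +_) (∑-neg xs f)) (sym (neg-distrib-+ (f x) (∑ xs f)))

∑-++ : ∀ (xs ys : List A) f → ∑ (xs ++ ys) f ≡ ∑ xs f + ∑ ys f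
∑-++ []       ys f = sym (+-identityˡ _)
∑-++ (x ∷ xs) ys f = trans (cong (f x +_) (∑-++ xs ys f)) (sym (+-assoc (f x) _ _))

∑-map : ∀ (h : A → B) xs f → ∑ (map h xs) f ≡ ∑ xs (f ∘ h)
∑-map h []       f = refl
∑-map h (x ∷ xs) f = cong (f (h x) +_) (∑-map h xs f)

∑-count : ∀ (xs : List A) {P : A → Set} (p? : Decidable P) (x : ℤ) →
          ℤ.+ length (filter p? xs) * x ≡ ∑ xs (λ y → [ p? y ]· x)
∑-count []       p? x = refl
∑-count (y ∷ xs) p? x with does (p? y)
... | true  = trans (*-distribʳ-+ x 1ℤ (ℤ.+ length (filter p? xs)))
                    (cong₂ _+_ (*-identityˡ x) (∑-count xs p? x))
... | false = trans (∑-count xs p? x) (sym (+-identityˡ _))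

∑-allSubsets-suc : ∀ m (f : Subset (suc m) → ℤ) →
  ∑ (allSubsets (suc m)) f ≡ ∑ (allSubsets m) (f ∘ (inside ∷_)) + ∑ (allSubsets m) (f ∘ (outside ∷_))
∑-allSubsets-suc m f = trans (∑-++ (map (inside ∷_) (allSubsets m)) _ f)
  (cong₂ _+_ (∑-map (inside ∷_) (allSubsets m) f) (∑-map (outside ∷_) (allSubsets m) f))

∑-allSubsets-⊥ : ∀ m (f : Subset m → ℤ) → (∀ D → Nonempty D → f D ≡ 0ℤ) → ∑ (allSubsets m) f ≡ f ⊥
∑-allSubsets-⊥ zero    f _   = +-identityʳ (f ⊥)
∑-allSubsets-⊥ (suc m) f f≗0 = begin
  ∑ (allSubsets (suc m)) f
    ≡⟨ ∑-allSubsets-suc m f ⟩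
  ∑ (allSubsets m) (f ∘ (inside ∷_)) + ∑ (allSubsets m) (f ∘ (outside ∷_))
    ≡⟨ cong₂ _+_ (∑-zero (allSubsets m) λ D → f≗0 (inside ∷ D) (zero , here))
                 (∑-allSubsets-⊥ m (f ∘ (outside ∷_)) λ { D (x , x∈D) →
                    f≗0 (outside ∷ D) (suc x , there x∈D) }) ⟩
  0ℤ + f ⊥
    ≡⟨ +-identityˡ _ ⟩
  f ⊥ ∎
  where open ≡-Reasoning

insert : Fin m → Subset m → Subset m
insert a D = D [ a ]≔ inside

a∈insert : ∀ (a : Fin m) D → a ∈ insert a D
a∈insert a D = []≔-updates D a

∈insert⁺ : ∀ {x} (a : Fin m) {D} → x ∈ D → x ∈ insert a D
∈insert⁺ {x = x} a {D} x∈D with x ≟ᶠ a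
... | yes refl = a∈insert a D
... | no  x≢a  = []≔-minimal D x a x≢a x∈D

∈insert⁻ : ∀ {x} (a : Fin m) D → x ∈ insert a D → x ≡ a ⊎ x ∈ D
∈insert⁻ {x = x} a D x∈D⁺ with x ≟ᶠ a
... | yes x≡a = inj₁ x≡a
... | no  x≢a = inj₂ (subst (x ∈_) (trans ([]≔-idempotent D a) ([]≔-lookup D a))
                              ([]≔-minimal (insert a D) x a x≢a x∈D⁺))

∑-pairing : ∀ (a : Fin m) (f g : Subset m → ℤ) →
            (∀ D → a ∉ D → f (insert a D) + f D ≡ - (g (insert a D) + g D)) →
            ∑ (allSubsets m) f ≡ - ∑ (allSubsets m) g
∑-pairing {suc m} zero f g pair = begin
  ∑ (allSubsets (suc m)) f
    ≡⟨ ∑-allSubsets-suc m f ⟩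
  ∑ (allSubsets m) (f ∘ (inside ∷_)) + ∑ (allSubsets m) (f ∘ (outside ∷_))
    ≡⟨ ∑-+ (allSubsets m) (f ∘ (inside ∷_)) (f ∘ (outside ∷_)) ⟨
  ∑ (allSubsets m) (λ D → f (inside ∷ D) + f (outside ∷ D))
    ≡⟨ ∑-cong (allSubsets m) (λ D → pair (outside ∷ D) λ ()) ⟩
  ∑ (allSubsets m) (λ D → - (g (inside ∷ D) + g (outside ∷ D)))
    ≡⟨ ∑-neg (allSubsets m) (λ D → g (inside ∷ D) + g (outside ∷ D)) ⟩
  - ∑ (allSubsets m) (λ D → g (inside ∷ D) + g (outside ∷ D))
    ≡⟨ cong -_ (∑-+ (allSubsets m) (g ∘ (inside ∷_)) (g ∘ (outside ∷_))) ⟩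
  - (∑ (allSubsets m) (g ∘ (inside ∷_)) + ∑ (allSubsets m) (g ∘ (outside ∷_)))
    ≡⟨ cong -_ (∑-allSubsets-suc m g) ⟨
  - ∑ (allSubsets (suc m)) g ∎
  where open ≡-Reasoning
∑-pairing {suc m} (suc a) f g pair = begin
  ∑ (allSubsets (suc m)) f
    ≡⟨ ∑-allSubsets-suc m f ⟩
  ∑ (allSubsets m) (f ∘ (inside ∷_)) + ∑ (allSubsets m) (f ∘ (outside ∷_))
    ≡⟨ cong₂ _+_ (∑-pairing a (f ∘ (inside ∷_)) (g ∘ (inside ∷_))
                   λ D a∉D → pair (inside ∷ D) (a∉D ∘ drop-there))
                 (∑-pairing a (f ∘ (outside ∷_)) (g ∘ (outside ∷_))
                   λ D a∉D → pair (outside ∷ D) (a∉D ∘ drop-there)) ⟩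
  - ∑ (allSubsets m) (g ∘ (inside ∷_)) + - ∑ (allSubsets m) (g ∘ (outside ∷_))
    ≡⟨ neg-distrib-+ (∑ (allSubsets m) (g ∘ (inside ∷_))) (∑ (allSubsets m) (g ∘ (outside ∷_))) ⟨
  - (∑ (allSubsets m) (g ∘ (inside ∷_)) + ∑ (allSubsets m) (g ∘ (outside ∷_)))
    ≡⟨ cong -_ (∑-allSubsets-suc m g) ⟨
  - ∑ (allSubsets (suc m)) g ∎
  where open ≡-Reasoning

sign : Subset m → ℤ
sign D = -1ℤ ^ ∣ D ∣

∣insert∣ : ∀ (a : Fin m) D → a ∉ D → ∣ insert a D ∣ ≡ suc ∣ D ∣
∣insert∣ zero    (outside ∷ D) _   = refl
∣insert∣ zero    (inside  ∷ D) a∉D = contradiction here a∉D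
∣insert∣ (suc a) (inside  ∷ D) a∉D = cong suc (∣insert∣ a D (a∉D ∘ there))
∣insert∣ (suc a) (outside ∷ D) a∉D = ∣insert∣ a D (a∉D ∘ there)

sign-insert : ∀ (a : Fin m) D → a ∉ D → sign (insert a D) ≡ - sign D
sign-insert a D a∉D rewrite ∣insert∣ a D a∉D = -1*i≡-i (sign D)

x∈p─q⇒x∉q : ∀ (p q : Subset m) {x} → x ∈ p ─ q → x ∉ q
x∈p─q⇒x∉q (_ ∷ p) (inside ∷ q) () here
x∈p─q⇒x∉q (_ ∷ p) (_      ∷ q) (there x∈p─q) (there x∈q) = x∈p─q⇒x∉q p q x∈p─q x∈q

x∈p-y⇒x≢y : ∀ (p : Subset m) {x y} → x ∈ p - y → x ≢ y
x∈p-y⇒x≢y p {y = y} x∈p-y refl = x∈p─q⇒x∉q p ⁅ y ⁆ x∈p-y (x∈⁅x⁆ y)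

sum1to-cong : ∀ m {f g : ℕ → ℤ} → (∀ i → f i ≡ g i) → sum1to m f ≡ sum1to m g
sum1to-cong zero    f≗g = refl
sum1to-cong (suc m) f≗g = cong₂ _+_ (sum1to-cong m f≗g) (f≗g (suc m))

sum1to-zero : ∀ m {f : ℕ → ℤ} → (∀ i → i ≤ m → f i ≡ 0ℤ) → sum1to m f ≡ 0ℤ
sum1to-zero zero    f≗0 = refl
sum1to-zero (suc m) f≗0 rewrite f≗0 (suc m) ≤-refl =
  trans (+-identityʳ _) (sum1to-zero m λ i i≤m → f≗0 i (m≤n⇒m≤1+n i≤m))

sum1to-∑ : ∀ m (xs : List A) (g : ℕ → A → ℤ) →
           sum1to m (λ i → ∑ xs (g i)) ≡ ∑ xs (λ y → sum1to m (λ i → g i y))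
sum1to-∑ zero    xs g = sym (∑-zero xs λ _ → refl)
sum1to-∑ (suc m) xs g = trans (cong (_+ ∑ xs (g (suc m))) (sum1to-∑ m xs g))
                              (sym (∑-+ xs (λ y → sum1to m (λ i → g i y)) (g (suc m))))

sum1to-δ : ∀ m {j} (f : ℕ → ℤ) → 1 ≤ j → j ≤ m → sum1to m (λ i → [ j ℕ.≟ i ]· f i) ≡ f j
sum1to-δ zero        f (s≤s _) ()
sum1to-δ (suc m) {j} f 1≤j j≤1+m with j ℕ.≟ suc m
... | yes refl  = trans (cong₂ _+_ (sum1to-zero m λ i i≤m →
                                     []·-no (λ { refl → <-irrefl refl i≤m }) (j ℕ.≟ i) (f i))
                                   ([]·-yes refl (j ℕ.≟ j) (f j)))
                        (+-identityˡ (f j))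
... | no  j≢1+m = trans (cong₂ _+_ (sum1to-δ m f 1≤j (m<1+n⇒m≤n (≤∧≢⇒< j≤1+m j≢1+m)))
                                   ([]·-no j≢1+m (j ℕ.≟ suc m) (f (suc m))))
                        (+-identityʳ (f j))

sum1to-δ-× : ∀ m {j} (f : ℕ → ℤ) (q? : Dec Q) → (Q → 1 ≤ j × j ≤ m) →
             sum1to m (λ i → [ (j ℕ.≟ i) ×-dec q? ]· f i) ≡ [ q? ]· f j
sum1to-δ-× m {j} f q? bounds = trans (sum1to-cong m λ i → []·-×-dec (j ℕ.≟ i) q? (f i)) (by q?)
  where
  by : ∀ q? → sum1to m (λ i → [ q? ]· [ j ℕ.≟ i ]· f i) ≡ [ q? ]· f j
  by (yes q) = let (1≤j , j≤m) = bounds q in sum1to-δ m f 1≤j j≤m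
  by (no  _) = sum1to-zero m λ _ _ → refl

InjectiveBelow : (ℕ → A) → ℕ → Set
InjectiveBelow w j = ∀ {a b} → a < b → b < j → w a ≢ w b

injectiveBelow-suc : ∀ {w : ℕ → A} {j} → InjectiveBelow w j → (∀ (i : Fin j) → w (toℕ i) ≢ w j) →
                     InjectiveBelow w (suc j)
injectiveBelow-suc {w = w} inj new {a} {b} a<b b<1+j with m<1+n⇒m<n∨m≡n b<1+j
... | inj₁ b<j  = inj a<b b<j
... | inj₂ refl = subst (λ k → w k ≢ w b) (toℕ-fromℕ< a<b) (new (fromℕ< a<b))

module _ (G : Graph) where

  _~_ : Fin (n G) → Fin (n G) → Set
  u ~ v = adj G u v ≡ true

  _~?_ : ∀ u v → Dec (u ~ v)
  u ~? v = adj G u v ≟ᵇ true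

  ~-sym : ∀ {u v} → u ~ v → v ~ u
  ~-sym {u} {v} u~v = trans (Graph.sym G v u) u~v

  ~-irrefl : ∀ {v} → ¬ v ~ v
  ~-irrefl {v} v~v with () ← trans (sym v~v) (irrefl G v)

  nbhd : Fin (n G) → Subset (n G)
  nbhd v = tabulate (adj G v)

  ∈nbhd⁺ : ∀ {v x} → v ~ x → x ∈ nbhd v
  ∈nbhd⁺ {v} {x} v~x = lookup⇒[]= x (nbhd v) (trans (lookup∘tabulate (adj G v) x) v~x)

  ∈nbhd⁻ : ∀ {v x} → x ∈ nbhd v → v ~ x
  ∈nbhd⁻ {v} {x} x∈N = trans (sym (lookup∘tabulate (adj G v) x)) ([]=⇒lookup x∈N)

  HasNeighbourIn : Subset (n G) → Fin (n G) → Set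
  HasNeighbourIn D v = ∃ λ u → u ∈ D × v ~ u

  hasNeighbourIn? : ∀ D v → Dec (HasNeighbourIn D v)
  hasNeighbourIn? D v = any? λ u → (u ∈? D) ×-dec (v ~? u)

  IsolatedIn : Subset (n G) → Fin (n G) → Set
  IsolatedIn S v = ∀ u → u ∈ S → ¬ v ~ u

  isolatedIn? : ∀ S v → Dec (IsolatedIn S v)
  isolatedIn? S v = all? λ u → (u ∈? S) →-dec ¬? (v ~? u)

  UniqueNeighbourIn : Subset (n G) → Fin (n G) → Fin (n G) → Set
  UniqueNeighbourIn S ℓ s = s ∈ S × ℓ ~ s × ∀ u → u ∈ S → ℓ ~ u → u ≡ s

  uniqueNeighbourIn? : ∀ S ℓ s → Dec (UniqueNeighbourIn S ℓ s)
  uniqueNeighbourIn? S ℓ s = (s ∈? S) ×-dec (ℓ ~? s) ×-dec all? λ u → (u ∈? S) →-dec (ℓ ~? u) →-dec (u ≟ᶠ s)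

  IsDominator : (S T D : Subset (n G)) → Set
  IsDominator S T D = D ⊆ T × (∀ v → v ∈ S → HasNeighbourIn D v)

  isDominator? : ∀ S T D → Dec (IsDominator S T D)
  isDominator? S T D = (D ⊆? T) ×-dec all? λ v → (v ∈? S) →-dec hasNeighbourIn? D v

  weight : (S T D : Subset (n G)) → ℤ
  weight S T D = [ isDominator? S T D ]· sign D

  Φ : Subset (n G) → Subset (n G) → ℤ
  Φ S T = ∑ (allSubsets (n G)) (weight S T)

  Φ-⊥ : Φ ⊥ ⊥ ≡ 1ℤ
  Φ-⊥ = begin
    ∑ (allSubsets (n G)) (weight ∅ ∅)
      ≡⟨ ∑-allSubsets-⊥ (n G) (weight ∅ ∅) nonempty-excluded ⟩
    weight ∅ ∅ ∅
      ≡⟨ []·-yes ⊥-dominates (isDominator? ∅ ∅ ∅) (sign ∅) ⟩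
    sign ∅
      ≡⟨ cong (-1ℤ ^_) (∣⊥∣≡0 (n G)) ⟩
    1ℤ ∎
    where
    open ≡-Reasoning
    ∅ : Subset (n G)
    ∅ = ⊥
    ⊥-dominates : IsDominator ∅ ∅ ∅
    ⊥-dominates = (λ {_} → ⊥⊆) , λ _ v∈⊥ → contradiction v∈⊥ ∉⊥
    nonempty-excluded : ∀ D → Nonempty D → weight ∅ ∅ D ≡ 0ℤ
    nonempty-excluded D (x , x∈D) = []·-no (λ (D⊆⊥ , _) → ∉⊥ (D⊆⊥ x∈D)) (isDominator? ∅ ∅ D) (sign D)

  Φ-isolated : ∀ {S T v} → v ∈ S → IsolatedIn T v → Φ S T ≡ 0ℤ
  Φ-isolated {S} {T} {v} v∈S isolated = ∑-zero (allSubsets (n G)) λ D →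
    []·-no (λ (D⊆T , dom) → let (u , u∈D , v~u) = dom v v∈S in isolated u (D⊆T u∈D) v~u)
           (isDominator? S T D) (sign D)

  Φ-uniqueNeighbourInT : ∀ {S T v a} → v ∈ S → a ∈ T → (∀ u → u ∈ T → v ~ u → u ≡ a) →
                         Φ S T ≡ - Φ (S ─ nbhd a) (T - a)
  Φ-uniqueNeighbourInT {S} {T} {v} {a} v∈S a∈T unique =
    ∑-pairing a (weight S T) (weight S′ T′) pair
    where
    S′ T′ : Subset (n G)
    S′ = S ─ nbhd a
    T′ = T - a

    module _ (D : Subset (n G)) (a∉D : a ∉ D) where
      D⁺ = insert a D

      v-undominated : ¬ IsDominator S T D
      v-undominated (D⊆T , dom) =
        let (u , u∈D , v~u) = dom v v∈S in a∉D (subst (_∈ D) (unique u (D⊆T u∈D) v~u) u∈D)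

      a-excluded : ¬ IsDominator S′ T′ D⁺
      a-excluded (D⁺⊆T′ , _) = x∈p-y⇒x≢y T (D⁺⊆T′ (a∈insert a D)) refl

      D⁺-dominates : IsDominator S T D⁺ ⇔ IsDominator S′ T′ D
      D⁺-dominates = mk⇔ to from
        where
        to : IsDominator S T D⁺ → IsDominator S′ T′ D
        to (D⁺⊆T , dom) = D⊆T′ , dom′
          where
          D⊆T′ : D ⊆ T′
          D⊆T′ x∈D = x∈p∧x≢y⇒x∈p-y (D⁺⊆T (∈insert⁺ a x∈D)) λ { refl → a∉D x∈D }
          dom′ : ∀ x → x ∈ S′ → HasNeighbourIn D x
          dom′ x x∈S′ with dom x (p─q⊆p S _ x∈S′)
          ... | u , u∈D⁺ , x~u with ∈insert⁻ a D u∈D⁺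
          ...   | inj₁ refl = contradiction (∈nbhd⁺ (~-sym x~u)) (x∈p─q⇒x∉q S _ x∈S′)
          ...   | inj₂ u∈D  = u , u∈D , x~u

        from : IsDominator S′ T′ D → IsDominator S T D⁺
        from (D⊆T′ , dom′) = D⁺⊆T , dom
          where
          D⁺⊆T : D⁺ ⊆ T
          D⁺⊆T x∈D⁺ with ∈insert⁻ a D x∈D⁺
          ... | inj₁ refl = a∈T
          ... | inj₂ x∈D  = p─q⊆p T _ (D⊆T′ x∈D)
          dom : ∀ x → x ∈ S → HasNeighbourIn D⁺ x
          dom x x∈S with x ~? a
          ... | yes x~a = a , a∈insert a D , x~a
          ... | no ¬x~a =
            let (u , u∈D , x~u) = dom′ x (x∈p∧x∉q⇒x∈p─q x∈S (¬x~a ∘ ~-sym ∘ ∈nbhd⁻))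
            in u , ∈insert⁺ a u∈D , x~u

      pair : weight S T D⁺ + weight S T D ≡ - (weight S′ T′ D⁺ + weight S′ T′ D)
      pair = begin
        weight S T D⁺ + weight S T D
          ≡⟨ cong (weight S T D⁺ +_) ([]·-no v-undominated (isDominator? S T D) (sign D)) ⟩
        weight S T D⁺ + 0ℤ
          ≡⟨ +-identityʳ _ ⟩
        [ isDominator? S T D⁺ ]· sign D⁺
          ≡⟨ []·-⇔ D⁺-dominates (isDominator? S T D⁺) (isDominator? S′ T′ D) (sign D⁺) ⟩
        [ isDominator? S′ T′ D ]· sign D⁺
          ≡⟨ cong [ isDominator? S′ T′ D ]·_ (sign-insert a D a∉D) ⟩
        [ isDominator? S′ T′ D ]· (- sign D)
          ≡⟨ []·-neg (isDominator? S′ T′ D) (sign D) ⟩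
        - weight S′ T′ D
          ≡⟨ cong -_ (+-identityˡ _) ⟨
        - (0ℤ + weight S′ T′ D)
          ≡⟨ cong (λ w → - (w + weight S′ T′ D)) ([]·-no a-excluded (isDominator? S′ T′ D⁺) (sign D⁺)) ⟨
        - (weight S′ T′ D⁺ + weight S′ T′ D) ∎
        where open ≡-Reasoning

  Φ-uniqueNeighbourInS : ∀ {S T v a} → a ∈ T → v ∈ S → v ~ a → (∀ x → x ∈ S → x ~ a → x ≡ v) →
                         Φ S T ≡ - Φ (S - v) (T ─ nbhd v)
  Φ-uniqueNeighbourInS {S} {T} {v} {a} a∈T v∈S v~a unique =
    ∑-pairing a (weight S T) (weight S′ T′) pair
    where
    S′ T′ : Subset (n G)
    S′ = S - v
    T′ = T ─ nbhd v

    module _ (D : Subset (n G)) (a∉D : a ∉ D) where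
      D⁺ = insert a D

      E? : Dec (IsDominator S′ T D)
      E? = isDominator? S′ T D

      v? : Dec (HasNeighbourIn D v)
      v? = hasNeighbourIn? D v

      a-excluded : ¬ IsDominator S′ T′ D⁺
      a-excluded (D⁺⊆T′ , _) = x∈p─q⇒x∉q T (nbhd v) (D⁺⊆T′ (a∈insert a D)) (∈nbhd⁺ v~a)

      D⁺-dominates : IsDominator S T D⁺ ⇔ IsDominator S′ T D
      D⁺-dominates = mk⇔ to from
        where
        to : IsDominator S T D⁺ → IsDominator S′ T D
        to (D⁺⊆T , dom) = D⁺⊆T ∘ ∈insert⁺ a , dom′
          where
          dom′ : ∀ x → x ∈ S′ → HasNeighbourIn D x
          dom′ x x∈S′ with dom x (p─q⊆p S _ x∈S′)
          ... | u , u∈D⁺ , x~u with ∈insert⁻ a D u∈D⁺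
          ...   | inj₁ refl = contradiction (unique x (p─q⊆p S _ x∈S′) x~u) (x∈p-y⇒x≢y S x∈S′)
          ...   | inj₂ u∈D  = u , u∈D , x~u
        from : IsDominator S′ T D → IsDominator S T D⁺
        from (D⊆T , dom′) = D⁺⊆T , dom
          where
          D⁺⊆T : D⁺ ⊆ T
          D⁺⊆T x∈D⁺ with ∈insert⁻ a D x∈D⁺
          ... | inj₁ refl = a∈T
          ... | inj₂ x∈D  = D⊆T x∈D
          dom : ∀ x → x ∈ S → HasNeighbourIn D⁺ x
          dom x x∈S with x ≟ᶠ v
          ... | yes refl = a , a∈insert a D , v~a
          ... | no  x≢v  = let (u , u∈D , x~u) = dom′ x (x∈p∧x≢y⇒x∈p-y x∈S x≢v) in u , ∈insert⁺ a u∈D , x~u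

      D-dominates : IsDominator S T D ⇔ (IsDominator S′ T D × HasNeighbourIn D v)
      D-dominates = mk⇔ (λ (D⊆T , dom) → (D⊆T , λ x x∈S′ → dom x (p─q⊆p S _ x∈S′)) , dom v v∈S) from
        where
        from : IsDominator S′ T D × HasNeighbourIn D v → IsDominator S T D
        from ((D⊆T , dom′) , v-dominated) = D⊆T , dom
          where
          dom : ∀ x → x ∈ S → HasNeighbourIn D x
          dom x x∈S with x ≟ᶠ v
          ... | yes refl = v-dominated
          ... | no  x≢v  = dom′ x (x∈p∧x≢y⇒x∈p-y x∈S x≢v)

      D-dominates′ : IsDominator S′ T′ D ⇔ (IsDominator S′ T D × ¬ HasNeighbourIn D v)
      D-dominates′ = mk⇔ to from
        where
        to : IsDominator S′ T′ D → IsDominator S′ T D × ¬ HasNeighbourIn D v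
        to (D⊆T′ , dom′) = (p─q⊆p T _ ∘ D⊆T′ , dom′) ,
                           λ (u , u∈D , v~u) → x∈p─q⇒x∉q T _ (D⊆T′ u∈D) (∈nbhd⁺ v~u)
        from : IsDominator S′ T D × ¬ HasNeighbourIn D v → IsDominator S′ T′ D
        from ((D⊆T , dom′) , v-undominated) =
          (λ {u} u∈D → x∈p∧x∉q⇒x∈p─q (D⊆T u∈D) λ u∈N → v-undominated (u , u∈D , ∈nbhd⁻ u∈N)) , dom′

      pair : weight S T D⁺ + weight S T D ≡ - (weight S′ T′ D⁺ + weight S′ T′ D)
      pair = begin
        weight S T D⁺ + weight S T D
          ≡⟨ cong₂ _+_ ([]·-⇔ D⁺-dominates (isDominator? S T D⁺) E? (sign D⁺))
                       ([]·-⇔ D-dominates (isDominator? S T D) (E? ×-dec v?) (sign D)) ⟩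
        [ E? ]· sign D⁺ + [ E? ×-dec v? ]· sign D
          ≡⟨ cong (λ s → [ E? ]· s + [ E? ×-dec v? ]· sign D) (sign-insert a D a∉D) ⟩
        [ E? ]· (- sign D) + [ E? ×-dec v? ]· sign D
          ≡⟨ []·-complement E? v? (sign D) ⟩
        - ([ E? ×-dec ¬? v? ]· sign D)
          ≡⟨ cong -_ (+-identityˡ _) ⟨
        - (0ℤ + [ E? ×-dec ¬? v? ]· sign D)
          ≡⟨ cong -_ (cong₂ _+_ ([]·-no a-excluded (isDominator? S′ T′ D⁺) (sign D⁺))
                                ([]·-⇔ D-dominates′ (isDominator? S′ T′ D) (E? ×-dec ¬? v?) (sign D))) ⟨
        - (weight S′ T′ D⁺ + weight S′ T′ D) ∎
        where open ≡-Reasoning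

  closedWalk⇒cycle : (c : ℕ → Fin (n G)) → (∀ k → c k ~ c (suc k)) → (∀ k → c (2 ℕ.+ k) ≢ c k) →
                     ∀ L → c (suc L) ≡ c 0 → InjectiveBelow c (suc L) → Cycle G
  closedWalk⇒cycle c step nonBack 0             closes _   =
    ⊥-elim (~-irrefl (subst (c 0 ~_) closes (step 0)))
  closedWalk⇒cycle c step nonBack 1             closes _   = ⊥-elim (nonBack 0 closes)
  closedWalk⇒cycle c step nonBack (suc (suc k)) closes inj = record
    { k       = k
    ; c       = c ∘ toℕ
    ; c-inj   = c-inj
    ; c-step  = λ i → subst (λ j → c j ~ c (suc (toℕ i))) (sym (toℕ-inject₁ i)) (step (toℕ i))
    ; c-close = subst₂ _~_ (cong c (sym (toℕ-fromℕ (suc (suc k))))) closes (step (suc (suc k)))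
    }
    where
    c-inj : ∀ {x y} → c (toℕ x) ≡ c (toℕ y) → x ≡ y
    c-inj {x} {y} cx≡cy with <-cmp (toℕ x) (toℕ y)
    ... | tri< x<y _ _ = ⊥-elim (inj x<y (toℕ<n y) cx≡cy)
    ... | tri≈ _ x≡y _ = toℕ-injective x≡y
    ... | tri> _ _ y<x = ⊥-elim (inj y<x (toℕ<n x) (sym cx≡cy))

  module _ (w : ℕ → Fin (n G)) (step : ∀ k → w k ~ w (suc k)) (nonBack : ∀ k → w (2 ℕ.+ k) ≢ w k) where

    injectiveBelow-or-cycle : ∀ j → InjectiveBelow w j ⊎ Cycle G
    injectiveBelow-or-cycle zero    = inj₁ λ _ ()
    injectiveBelow-or-cycle (suc j) with injectiveBelow-or-cycle j
    ... | inj₂ cycle = inj₂ cycle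
    ... | inj₁ inj with any? (λ (i : Fin j) → w (toℕ i) ≟ᶠ w j)
    ...   | no  ¬repeat = inj₁ (injectiveBelow-suc inj λ i wi≡wj → ¬repeat (i , wi≡wj))
    ...   | yes (i , wi≡wj) with m≤n⇒∃[o]m+o≡n (toℕ<n i)
    ...     | L , i+1+L≡j =
      inj₂ (closedWalk⇒cycle (λ k → w (k ℕ.+ toℕ i)) (λ k → step (k ℕ.+ toℕ i)) (λ k → nonBack (k ℕ.+ toℕ i))
                             L closes shifted-inj)
      where
      1+L+i≡j : suc L ℕ.+ toℕ i ≡ j
      1+L+i≡j = trans (cong suc (+-comm L (toℕ i))) i+1+L≡j
      closes : w (suc L ℕ.+ toℕ i) ≡ w (toℕ i)
      closes = trans (cong w 1+L+i≡j) (sym wi≡wj)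
      shifted-inj : InjectiveBelow (λ k → w (k ℕ.+ toℕ i)) (suc L)
      shifted-inj {b = b} a<b b<1+L =
        inj (+-monoˡ-< (toℕ i) a<b) (subst (b ℕ.+ toℕ i <_) 1+L+i≡j (+-monoˡ-< (toℕ i) b<1+L))

    nonBacktrackingWalk⇒cycle : Cycle G
    nonBacktrackingWalk⇒cycle with injectiveBelow-or-cycle (suc (n G))
    ... | inj₂ cycle = cycle
    ... | inj₁ inj with pigeonhole (n<1+n (n G)) (w ∘ toℕ)
    ...   | i , j , i<j , wi≡wj = ⊥-elim (inj i<j (toℕ<n j) wi≡wj)

  record ArcIn (S : Subset (n G)) : Set where
    constructor arc
    field
      tail head : Fin (n G)
      tail∈S    : tail ∈ S
      head∈S    : head ∈ S
      tail~head : tail ~ head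

  noLeaf⇒cycle : ∀ {S p c} → p ∈ S → c ∈ S → p ~ c →
                 (∀ {p c} → p ∈ S → c ∈ S → p ~ c → ∃ λ c′ → c′ ∈ S × c ~ c′ × c′ ≢ p) → Cycle G
  noLeaf⇒cycle {S} {p} {c} p∈S c∈S p~c turn =
    nonBacktrackingWalk⇒cycle (tail ∘ arcs) (tail~head ∘ arcs) (λ k → no-backtrack (arcs k))
    where
    open ArcIn
    next : ArcIn S → ArcIn S
    next a = let (c′ , c′∈S , c~c′ , _) = turn (tail∈S a) (head∈S a) (tail~head a)
             in arc (head a) c′ (head∈S a) c′∈S c~c′
    no-backtrack : ∀ a → head (next a) ≢ tail a
    no-backtrack a = let (_ , _ , _ , c′≢p) = turn (tail∈S a) (head∈S a) (tail~head a) in c′≢p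
    arcs : ℕ → ArcIn S
    arcs zero    = arc p c p∈S c∈S p~c
    arcs (suc k) = next (arcs k)

  forest⇒lowDegree : IsForest G → ∀ {S v} → v ∈ S →
                     (∃ λ v → v ∈ S × IsolatedIn S v) ⊎ (∃₂ λ ℓ s → ℓ ∈ S × UniqueNeighbourIn S ℓ s)
  forest⇒lowDegree forest {S} {v} v∈S
    with any? (λ v → (v ∈? S) ×-dec isolatedIn? S v)
       | any? (λ ℓ → any? λ s → (ℓ ∈? S) ×-dec uniqueNeighbourIn? S ℓ s)
  ... | yes isolated | _         = inj₁ isolated
  ... | no  _        | yes leaf  = inj₂ leaf
  ... | no ¬isolated | no ¬leaf  =
    let (u , u∈S , v~u) = neighbour v∈S in ⊥-elim (forest (noLeaf⇒cycle v∈S u∈S v~u turn))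
    where
    neighbour : ∀ {v} → v ∈ S → ∃ λ u → u ∈ S × v ~ u
    neighbour {v} v∈S with any? (λ u → (u ∈? S) ×-dec (v ~? u))
    ... | yes found = found
    ... | no  none  = ⊥-elim (¬isolated (v , v∈S , λ u u∈S v~u → none (u , u∈S , v~u)))
    turn : ∀ {p c} → p ∈ S → c ∈ S → p ~ c → ∃ λ c′ → c′ ∈ S × c ~ c′ × c′ ≢ p
    turn {p} {c} p∈S c∈S p~c with any? (λ c′ → (c′ ∈? S) ×-dec (c ~? c′) ×-dec ¬? (c′ ≟ᶠ p))
    ... | yes found = found
    ... | no  none  = ⊥-elim (¬leaf (c , p , c∈S , p∈S , ~-sym p~c , only-p))
      where
      only-p : ∀ u → u ∈ S → c ~ u → u ≡ p
      only-p u u∈S c~u = decidable-stable (u ≟ᶠ p) λ u≢p → none (u , u∈S , c~u , u≢p)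

  Φ-leaf : ∀ {S ℓ s} → ℓ ∈ S → UniqueNeighbourIn S ℓ s → Φ S S ≡ Φ (S - s ─ nbhd s) (S - s ─ nbhd s)
  Φ-leaf {S} {ℓ} {s} ℓ∈S (s∈S , ℓ~s , unique) = begin
    Φ S S
      ≡⟨ Φ-uniqueNeighbourInT ℓ∈S s∈S unique ⟩
    - Φ (S ─ nbhd s) (S - s)
      ≡⟨ cong -_ (Φ-uniqueNeighbourInS ℓ∈S-s s∈S─N (~-sym ℓ~s) unique′) ⟩
    - - Φ (S ─ nbhd s - s) (S - s ─ nbhd s)
      ≡⟨ neg-involutive _ ⟩
    Φ (S ─ nbhd s - s) (S - s ─ nbhd s)
      ≡⟨ cong (λ R → Φ R (S - s ─ nbhd s)) (p─q─r≡p─r─q S (nbhd s) ⁅ s ⁆) ⟩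
    Φ (S - s ─ nbhd s) (S - s ─ nbhd s) ∎
    where
    open ≡-Reasoning
    ℓ∈S-s : ℓ ∈ S - s
    ℓ∈S-s = x∈p∧x≢y⇒x∈p-y ℓ∈S λ { refl → ~-irrefl ℓ~s }
    s∈S─N : s ∈ S ─ nbhd s
    s∈S─N = x∈p∧x∉q⇒x∈p─q s∈S (~-irrefl ∘ ∈nbhd⁻)
    unique′ : ∀ x → x ∈ S ─ nbhd s → x ~ ℓ → x ≡ s
    unique′ x x∈S─N x~ℓ = unique x (p─q⊆p S _ x∈S─N) (~-sym x~ℓ)

  Φ-forest : IsForest G → ∀ S → Φ S S ≡ 0ℤ ⊎ Φ S S ≡ 1ℤ
  Φ-forest forest S = go S (<-wellFounded ∣ S ∣)
    where
    go : ∀ S → Acc _<_ ∣ S ∣ → Φ S S ≡ 0ℤ ⊎ Φ S S ≡ 1ℤ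
    go S (acc smaller) with nonempty? S
    ... | no  empty = inj₂ (subst (λ R → Φ R R ≡ 1ℤ) (sym (Empty-unique empty)) Φ-⊥)
    ... | yes (v , v∈S) with forest⇒lowDegree forest v∈S
    ...   | inj₁ (u , u∈S , isolated) = inj₁ (Φ-isolated u∈S isolated)
    ...   | inj₂ (ℓ , s , ℓ∈S , leaf@(s∈S , _)) rewrite Φ-leaf ℓ∈S leaf =
      go (S - s ─ nbhd s) (smaller (≤-<-trans (∣p─q∣≤∣p∣ (S - s) (nbhd s)) (x∈p⇒∣p-x∣<∣p∣ s∈S)))

  -- The vertex rules out the empty set, which Φ counts but D_t does not.
  Dt≡Φ : Fin (n G) → Dt G -1ℤ ≡ Φ ⊤ ⊤
  Dt≡Φ v = begin
    sum1to (n G) (λ i → ℤ.+ dt G i * -1ℤ ^ i)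
      ≡⟨ sum1to-cong (n G) (λ i → ∑-count 𝒫 (λ D → (∣ D ∣ ℕ.≟ i) ×-dec tds? D) (-1ℤ ^ i)) ⟩
    sum1to (n G) (λ i → ∑ 𝒫 (λ D → [ (∣ D ∣ ℕ.≟ i) ×-dec tds? D ]· -1ℤ ^ i))
      ≡⟨ sum1to-∑ (n G) 𝒫 (λ i D → [ (∣ D ∣ ℕ.≟ i) ×-dec tds? D ]· -1ℤ ^ i) ⟩
    ∑ 𝒫 (λ D → sum1to (n G) (λ i → [ (∣ D ∣ ℕ.≟ i) ×-dec tds? D ]· -1ℤ ^ i))
      ≡⟨ ∑-cong 𝒫 (λ D → sum1to-δ-× (n G) (-1ℤ ^_) (tds? D) (size-bounds D)) ⟩
    ∑ 𝒫 (λ D → [ tds? D ]· sign D)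
      ≡⟨ ∑-cong 𝒫 (λ D → []·-⇔ total⇔⊤ (tds? D) (isDominator? ⊤ ⊤ D) (sign D)) ⟩
    Φ ⊤ ⊤ ∎
    where
    open ≡-Reasoning
    𝒫 : List (Subset (n G))
    𝒫 = allSubsets (n G)
    tds? = isTotalDominating? G
    total⇔⊤ : ∀ {D} → IsTotalDominating G D ⇔ IsDominator ⊤ ⊤ D
    total⇔⊤ = mk⇔ (λ tds → (λ {_} _ → ∈⊤) , λ x _ → tds x) (λ (_ , dom) x → dom x ∈⊤)
    size-bounds : ∀ D → IsTotalDominating G D → 1 ≤ ∣ D ∣ × ∣ D ∣ ≤ n G
    size-bounds D tds = let (u , u∈D , _) = tds v in ≤-<-trans z≤n (x∈p⇒∣p-x∣<∣p∣ u∈D) , ∣p∣≤n D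

theorem7 : (F : Graph) → IsForest F → (Dt F -1ℤ ≡ 0ℤ) ⊎ (Dt F -1ℤ ≡ 1ℤ)
theorem7 record { n = zero }    _      = inj₁ refl
theorem7 F@record { n = suc _ } forest rewrite Dt≡Φ F zero = Φ-forest F forest ⊤
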